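{- Let $n,s,k$ be integers with $k\ge 0$ and $k+1\le s\le n$. Then $p^s_{n+1;\le s;k}=p_{n;\le s;k}$.
   Context: Parking model: there are $m$ parking spaces in a line, numbered $1,\dots,m$. A preference set of length $N$ is a sequence $(a_1,\dots,a_N)$ of integers with $1\le a_i\le m$; cars $1,\dots,N$ arrive in order, car $i$ parks in the first unoccupied space numbered $\ge a_i$ if one exists, otherwise it fails to park. It is a $k$-flaw preference set if exactly $k$ cars fail to park. $p_{N;\le s;k}$ denotes the number of $k$-flaw preference sets of length $N$ with $m=N$ spaces and all $a_i\le s$, and $p^l_{N;\le s;k}$ the number of those with $a_1=l$. (So the left side concerns $n+1$ cars and $n+1$ spaces, the right side $n$ cars and $n$ spaces.) -}

module Defs where

open import Data.Nat using (ℕ; zero; suc; _+_; _≡ᵇ_; _≤ᵇ_)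
open import Data.Bool using (Bool; true; false; if_then_else_; _∧_)
open import Data.List using (List; []; _∷_; map; upTo; concatMap; replicate; length; filter)
open import Data.Maybe using (Maybe; just; nothing)
import Data.Maybe as Maybe

-- Occupancy of the spaces 1..m as a list of Booleans (true = occupied),
-- the head being space 1.
-- parkFrom occ a : a car preferring space a (1-indexed; 0 treated like 1)
-- takes the first unoccupied space numbered ≥ a; nothing if none exists.
parkFrom : List Bool → ℕ → Maybe (List Bool)
parkFrom []           _             = nothing
parkFrom (b ∷ bs)     (suc (suc a)) = Maybe.map (b ∷_) (parkFrom bs (suc a))
parkFrom (true ∷ bs)  a             = Maybe.map (true ∷_) (parkFrom bs a)
parkFrom (false ∷ bs) a             = just (true ∷ bs)

flawsFrom : List Bool → List ℕ → ℕ
flawsFrom occ []       = 0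
flawsFrom occ (a ∷ as) with parkFrom occ a
... | just occ' = flawsFrom occ' as
... | nothing   = suc (flawsFrom occ as)

flaws : (m : ℕ) → List ℕ → ℕ
flaws m as = flawsFrom (replicate m false) as

seqs : ℕ → List ℕ → List (List ℕ)
seqs zero    vals = [] ∷ []
seqs (suc l) vals = concatMap (λ v → map (v ∷_) (seqs l vals)) vals

prefSets : ℕ → List (List ℕ)
prefSets N = seqs N (map suc (upTo N))

allLeq : ℕ → List ℕ → Bool
allLeq s []       = true
allLeq s (a ∷ as) = (a ≤ᵇ s) ∧ allLeq s as

countWhere : {A : Set} → (A → Bool) → List A → ℕ
countWhere P []       = 0
countWhere P (x ∷ xs) = if P x then suc (countWhere P xs) else countWhere P xs

-- p_{N;≤s;k}: number of k-flaw preference sets of length N (m = N spaces)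
-- with all entries ≤ s.
p : (N s k : ℕ) → ℕ
p N s k = countWhere (λ as → allLeq s as ∧ (flaws N as ≡ᵇ k)) (prefSets N)

firstIs : ℕ → List ℕ → Bool
firstIs l []      = false
firstIs l (a ∷ _) = l ≡ᵇ a

-- p^l_{N;≤s;k}: those additionally with a_1 = l.
pˡ : (l N s k : ℕ) → ℕ
pˡ l N s k = countWhere (λ as → firstIs l as ∧ (allLeq s as ∧ (flaws N as ≡ᵇ k))) (prefSets N)

-- The first car prefers s ≤ n and so parks at space s of the empty lot. Every later
-- car prefers a space ≤ s, so it can only pass over the occupied space s, never stop
-- there: the remaining n cars behave exactly as on a lot of n spaces with space s
-- cut out, with the same failures. The tails are therefore the preference sets of
-- length n with entries ≤ s and the same number of flaws; the extra value n + 1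
-- allowed on the left is excluded by the bound s ≤ n.
module Submission where

open import Defs
open import Data.Bool using (Bool; true; false; T; if_then_else_; _∧_)
open import Data.Bool.Properties using (T-∧; T-≡)
open import Data.Empty using (⊥-elim)
open import Data.List using (List; []; _∷_; [_]; _++_; _∷ʳ_; map; concatMap; upTo; applyUpTo; replicate)
open import Data.List.Properties using (map-++; map-cong; map-upTo; upTo-∷ʳ)
open import Data.Maybe using (Maybe; just; nothing)
import Data.Maybe as Maybe
open import Data.Nat using (ℕ; zero; suc; _+_; _*_; _≤_; _<_; _≡ᵇ_; z≤n; s≤s)
open import Data.Nat.ListAction using (sum)
open import Data.Nat.ListAction.Properties using (sum-++)
open import Data.Nat.Properties using (≤⇒≤ᵇ; ≤ᵇ⇒≤; ≡ᵇ⇒≡; ≤-refl; ≤-trans; n≤1+n; <⇒≱; +-identityʳ; *-identityˡ; m+n≤o⇒n≤o)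
open import Data.Product using (proj₁; proj₂)
open import Function using (_∘_)
open import Function.Bundles using (Equivalence)
open import Relation.Nullary using (¬_)
open import Relation.Binary.PropositionalEquality using (_≡_; refl; sym; cong; cong₂; trans; module ≡-Reasoning)

open ≡-Reasoning

-- The inserted space becomes space j + 1 (or the last space, if occ is shorter).
insertOccupied : ℕ → List Bool → List Bool
insertOccupied zero    occ      = true ∷ occ
insertOccupied (suc j) []       = true ∷ []
insertOccupied (suc j) (b ∷ bs) = b ∷ insertOccupied j bs

map-∷-insertOccupied : ∀ b j (x : Maybe (List Bool)) →
  Maybe.map (b ∷_) (Maybe.map (insertOccupied j) x) ≡
  Maybe.map (insertOccupied (suc j)) (Maybe.map (b ∷_) x)
map-∷-insertOccupied b j (just _) = refl
map-∷-insertOccupied b j nothing  = refl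

-- A car preferring a space ≤ j + 1 meets the inserted space only as one to pass over.
parkFrom-insertOccupied : ∀ j occ a → a ≤ suc j →
  parkFrom (insertOccupied j occ) a ≡ Maybe.map (insertOccupied j) (parkFrom occ a)
parkFrom-insertOccupied zero    occ          zero          _         = refl
parkFrom-insertOccupied zero    occ          (suc zero)    _         = refl
parkFrom-insertOccupied zero    occ          (suc (suc a)) (s≤s ())
parkFrom-insertOccupied (suc j) []           zero          _         = refl
parkFrom-insertOccupied (suc j) []           (suc zero)    _         = refl
parkFrom-insertOccupied (suc j) []           (suc (suc a)) _         = refl
parkFrom-insertOccupied (suc j) (false ∷ bs) zero          _         = refl
parkFrom-insertOccupied (suc j) (false ∷ bs) (suc zero)    _         = refl
parkFrom-insertOccupied (suc j) (true ∷ bs)  zero          _         =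
  trans (cong (Maybe.map (true ∷_)) (parkFrom-insertOccupied j bs zero z≤n))
        (map-∷-insertOccupied true j (parkFrom bs zero))
parkFrom-insertOccupied (suc j) (true ∷ bs)  (suc zero)    _         =
  trans (cong (Maybe.map (true ∷_)) (parkFrom-insertOccupied j bs (suc zero) (s≤s z≤n)))
        (map-∷-insertOccupied true j (parkFrom bs (suc zero)))
parkFrom-insertOccupied (suc j) (b ∷ bs)     (suc (suc a)) (s≤s a≤j) =
  trans (cong (Maybe.map (b ∷_)) (parkFrom-insertOccupied j bs (suc a) a≤j))
        (map-∷-insertOccupied b j (parkFrom bs (suc a)))

flawsFrom-insertOccupied : ∀ j occ as → T (allLeq (suc j) as) →
  flawsFrom (insertOccupied j occ) as ≡ flawsFrom occ as
flawsFrom-insertOccupied j occ []       _       = refl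
flawsFrom-insertOccupied j occ (a ∷ as) bounded
  with parkFrom occ a | parkFrom (insertOccupied j occ) a
     | parkFrom-insertOccupied j occ a (≤ᵇ⇒≤ a (suc j) (proj₁ (Equivalence.to T-∧ bounded)))
... | just occ′ | .(just (insertOccupied j occ′)) | refl =
  flawsFrom-insertOccupied j occ′ as (proj₂ (Equivalence.to T-∧ bounded))
... | nothing   | .nothing                         | refl =
  cong suc (flawsFrom-insertOccupied j occ as (proj₂ (Equivalence.to T-∧ bounded)))

parkFrom-replicate-false : ∀ {j n} → j ≤ n →
  parkFrom (replicate (suc n) false) (suc j) ≡ just (insertOccupied j (replicate n false))
parkFrom-replicate-false {zero}          _         = refl
parkFrom-replicate-false {suc j} {suc n} (s≤s j≤n) rewrite parkFrom-replicate-false j≤n = refl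

flaws-suc-∷ : ∀ {j n} as → j ≤ n → T (allLeq (suc j) as) →
  flaws (suc n) (suc j ∷ as) ≡ flaws n as
flaws-suc-∷ as j≤n bounded rewrite parkFrom-replicate-false j≤n =
  flawsFrom-insertOccupied _ _ as bounded

countWhere-++ : ∀ {A : Set} (P : A → Bool) xs ys →
  countWhere P (xs ++ ys) ≡ countWhere P xs + countWhere P ys
countWhere-++ P []       ys = refl
countWhere-++ P (x ∷ xs) ys with P x
... | true  = cong suc (countWhere-++ P xs ys)
... | false = countWhere-++ P xs ys

countWhere-map : ∀ {A B : Set} (P : B → Bool) (f : A → B) xs →
  countWhere P (map f xs) ≡ countWhere (P ∘ f) xs
countWhere-map P f []       = refl
countWhere-map P f (x ∷ xs) with P (f x)
... | true  = cong suc (countWhere-map P f xs)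
... | false = countWhere-map P f xs

countWhere-cong : ∀ {A : Set} {P Q : A → Bool} → (∀ x → P x ≡ Q x) →
  ∀ xs → countWhere P xs ≡ countWhere Q xs
countWhere-cong         P≗Q []       = refl
countWhere-cong {Q = Q} P≗Q (x ∷ xs) rewrite P≗Q x with Q x
... | true  = cong suc (countWhere-cong P≗Q xs)
... | false = countWhere-cong P≗Q xs

countWhere-none : ∀ {A : Set} {P : A → Bool} → (∀ x → ¬ T (P x)) →
  ∀ xs → countWhere P xs ≡ 0
countWhere-none         none []       = refl
countWhere-none {P = P} none (x ∷ xs) with P x | none x
... | true  | ¬true = ⊥-elim (¬true _)
... | false | _     = countWhere-none none xs

countWhere-concatMap : ∀ {A B : Set} (P : B → Bool) (f : A → List B) xs →
  countWhere P (concatMap f xs) ≡ sum (map (countWhere P ∘ f) xs)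
countWhere-concatMap P f []       = refl
countWhere-concatMap P f (x ∷ xs) =
  trans (countWhere-++ P (f x) (concatMap f xs))
        (cong (countWhere P (f x) +_) (countWhere-concatMap P f xs))

countWhere-seqs-suc : ∀ (P : List ℕ → Bool) m vals →
  countWhere P (seqs (suc m) vals) ≡
  sum (map (λ v → countWhere (P ∘ (v ∷_)) (seqs m vals)) vals)
countWhere-seqs-suc P m vals =
  trans (countWhere-concatMap P (λ v → map (v ∷_) (seqs m vals)) vals)
        (cong sum (map-cong (λ v → countWhere-map P (v ∷_) (seqs m vals)) vals))

sum-map-if : ∀ {A : Set} (b : A → Bool) c xs →
  sum (map (λ x → if b x then c else 0) xs) ≡ countWhere b xs * c
sum-map-if b c []       = refl
sum-map-if b c (x ∷ xs) with b x
... | true  = cong (c +_) (sum-map-if b c xs)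
... | false = sum-map-if b c xs

countWhere-firstIs-seqs : ∀ s (Q : List ℕ → Bool) m vals →
  countWhere (λ as → firstIs s as ∧ Q as) (seqs (suc m) vals) ≡
  countWhere (s ≡ᵇ_) vals * countWhere (Q ∘ (s ∷_)) (seqs m vals)
countWhere-firstIs-seqs s Q m vals = begin
  countWhere (λ as → firstIs s as ∧ Q as) (seqs (suc m) vals)
    ≡⟨ countWhere-seqs-suc (λ as → firstIs s as ∧ Q as) m vals ⟩
  sum (map (λ v → countWhere (λ as → (s ≡ᵇ v) ∧ Q (v ∷ as)) (seqs m vals)) vals)
    ≡⟨ cong sum (map-cong column vals) ⟩
  sum (map (λ v → if s ≡ᵇ v then countWhere (Q ∘ (s ∷_)) (seqs m vals) else 0) vals)
    ≡⟨ sum-map-if (s ≡ᵇ_) _ vals ⟩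
  countWhere (s ≡ᵇ_) vals * countWhere (Q ∘ (s ∷_)) (seqs m vals) ∎
  where
  column : ∀ v → countWhere (λ as → (s ≡ᵇ v) ∧ Q (v ∷ as)) (seqs m vals) ≡
                 (if s ≡ᵇ v then countWhere (Q ∘ (s ∷_)) (seqs m vals) else 0)
  column v with s ≡ᵇ v in s≡ᵇv
  ... | true rewrite ≡ᵇ⇒≡ s v (Equivalence.from T-≡ s≡ᵇv) = refl
  ... | false = countWhere-none (λ _ ()) (seqs m vals)

BoundedBy : ℕ → (List ℕ → Bool) → Set
BoundedBy s P = ∀ as → T (P as) → T (allLeq s as)

countWhere-seqs-∷ʳ : ∀ {s y} (P : List ℕ → Bool) → BoundedBy s P → s < y →
  ∀ m xs → countWhere P (seqs m (xs ∷ʳ y)) ≡ countWhere P (seqs m xs)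
countWhere-seqs-∷ʳ P bounded s<y zero    xs = refl
countWhere-seqs-∷ʳ {s} {y} P bounded s<y (suc m) xs = begin
  countWhere P (seqs (suc m) (xs ∷ʳ y))   ≡⟨ countWhere-seqs-suc P m (xs ∷ʳ y) ⟩
  sum (map column (xs ++ [ y ]))           ≡⟨ cong sum (map-++ column xs [ y ]) ⟩
  sum (map column xs ++ [ column y ])      ≡⟨ sum-++ (map column xs) [ column y ] ⟩
  sum (map column xs) + (column y + 0)     ≡⟨ cong₂ _+_ (cong sum (map-cong column-restrict xs))
                                                        (cong (_+ 0) column-y) ⟩
  sum (map column′ xs) + 0                 ≡⟨ +-identityʳ _ ⟩
  sum (map column′ xs)                     ≡⟨ countWhere-seqs-suc P m xs ⟨
  countWhere P (seqs (suc m) xs)           ∎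
  where
  column column′ : ℕ → ℕ
  column  v = countWhere (P ∘ (v ∷_)) (seqs m (xs ∷ʳ y))
  column′ v = countWhere (P ∘ (v ∷_)) (seqs m xs)
  column-restrict : ∀ v → column v ≡ column′ v
  column-restrict v = countWhere-seqs-∷ʳ (P ∘ (v ∷_))
    (λ as t → proj₂ (Equivalence.to T-∧ (bounded (v ∷ as) t))) s<y m xs
  column-y : column y ≡ 0
  column-y = countWhere-none
    (λ as t → <⇒≱ s<y (≤ᵇ⇒≤ y s (proj₁ (Equivalence.to T-∧ (bounded (y ∷ as) t)))))
    (seqs m (xs ∷ʳ y))

countWhere-≡ᵇ-upTo : ∀ {i N} → i < N → countWhere (i ≡ᵇ_) (upTo N) ≡ 1
countWhere-≡ᵇ-upTo {zero}  {suc N} _ = begin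
  suc (countWhere (0 ≡ᵇ_) (applyUpTo suc N))    ≡⟨ cong (suc ∘ countWhere (0 ≡ᵇ_)) (map-upTo suc N) ⟨
  suc (countWhere (0 ≡ᵇ_) (map suc (upTo N)))   ≡⟨ cong suc (countWhere-map (0 ≡ᵇ_) suc (upTo N)) ⟩
  suc (countWhere (λ v → 0 ≡ᵇ suc v) (upTo N))  ≡⟨ cong suc (countWhere-none (λ _ ()) (upTo N)) ⟩
  1                                             ∎
countWhere-≡ᵇ-upTo {suc i} {suc N} (s≤s i<N) = begin
  countWhere (suc i ≡ᵇ_) (applyUpTo suc N)      ≡⟨ cong (countWhere (suc i ≡ᵇ_)) (map-upTo suc N) ⟨
  countWhere (suc i ≡ᵇ_) (map suc (upTo N))     ≡⟨ countWhere-map (suc i ≡ᵇ_) suc (upTo N) ⟩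
  countWhere (i ≡ᵇ_) (upTo N)                   ≡⟨ countWhere-≡ᵇ-upTo i<N ⟩
  1                                             ∎

oneTo-suc : ∀ n → map suc (upTo (suc n)) ≡ map suc (upTo n) ∷ʳ suc n
oneTo-suc n = trans (cong (map suc) (sym (upTo-∷ʳ n))) (map-++ suc (upTo n) [ n ])

theorem6p4 : (n s k : ℕ) → k + 1 ≤ s → s ≤ n →
    pˡ s (suc n) s k ≡ p n s k
theorem6p4 n zero    k k+1≤0 _   with () ← m+n≤o⇒n≤o k k+1≤0
theorem6p4 n (suc j) k _     s≤n = begin
  pˡ s (suc n) s k
    ≡⟨ countWhere-firstIs-seqs s Q n oneTo[n+1] ⟩
  countWhere (s ≡ᵇ_) oneTo[n+1] * countWhere (Q ∘ (s ∷_)) (seqs n oneTo[n+1])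
    ≡⟨ cong (_* countWhere (Q ∘ (s ∷_)) (seqs n oneTo[n+1])) s-occurs-once ⟩
  1 * countWhere (Q ∘ (s ∷_)) (seqs n oneTo[n+1])
    ≡⟨ *-identityˡ _ ⟩
  countWhere (Q ∘ (s ∷_)) (seqs n oneTo[n+1])
    ≡⟨ countWhere-cong first-car-parks-at-s (seqs n oneTo[n+1]) ⟩
  countWhere P (seqs n oneTo[n+1])
    ≡⟨ cong (countWhere P ∘ seqs n) (oneTo-suc n) ⟩
  countWhere P (seqs n (map suc (upTo n) ∷ʳ suc n))
    ≡⟨ countWhere-seqs-∷ʳ P (λ _ → proj₁ ∘ Equivalence.to T-∧) (s≤s s≤n) n (map suc (upTo n)) ⟩
  p n s k ∎
  where
  s : ℕ
  s = suc j
  j≤n : j ≤ n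
  j≤n = ≤-trans (n≤1+n j) s≤n
  oneTo[n+1] : List ℕ
  oneTo[n+1] = map suc (upTo (suc n))
  Q P : List ℕ → Bool
  Q as = allLeq s as ∧ (flaws (suc n) as ≡ᵇ k)
  P as = allLeq s as ∧ (flaws n as ≡ᵇ k)
  s-occurs-once : countWhere (s ≡ᵇ_) oneTo[n+1] ≡ 1
  s-occurs-once = trans (countWhere-map (s ≡ᵇ_) suc (upTo (suc n))) (countWhere-≡ᵇ-upTo (s≤s j≤n))
  first-car-parks-at-s : ∀ as → Q (s ∷ as) ≡ P as
  first-car-parks-at-s as rewrite Equivalence.to T-≡ (≤⇒≤ᵇ (≤-refl {s})) with allLeq s as in bounded
  ... | true  rewrite flaws-suc-∷ as j≤n (Equivalence.from T-≡ bounded) = refl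
  ... | false = refl
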